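{- Let $r\ge 3$ and $p,q\ge 0$ be integers with $p+q\ge 1$, and let $s=p+q+2$. If $p>0$ and $q>0$, then every irreducible permutation in $\mathrm{Av}(\alpha_r,\beta_{pq})$ has all decreasing subsequences of length at most $(r-1)(s-2)-1$; if $p=0$ or $q=0$, every such irreducible has all decreasing subsequences of length at most $(r-1)(s-2)$. Moreover, the length of an irreducible permutation in $\mathrm{Av}(\alpha_r,\beta_{pq})$ is at most $(r-1)^2(s-2)-(r-1)$ if $p>0$ and $q>0$, and at most $(r-1)^2(s-2)$ if $p=0$ or $q=0$.
   Context: $\alpha_r=12\cdots r$. $\beta_{pq}=\lambda\,(q+1)\,(q+2)\,\mu$, a permutation of length $p+q+2$, where $\lambda$ is the decreasing sequence $(p+q+2)(p+q+1)\cdots(q+3)$ of length $p$ and $\mu$ is the decreasing sequence $q(q-1)\cdots1$ of length $q$. $\mathrm{Av}(\alpha,\beta)$ is the set of permutations having no subsequence order isomorphic to $\alpha$ or to $\beta$. A permutation is irreducible if it has no segment (two adjacent entries) of the form $i+1,\,i$. -}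

module Defs where

open import Data.Nat using (ℕ; zero; suc; _+_; _*_; _∸_; _<_; _≤_; _<ᵇ_)
open import Data.Fin using (Fin; toℕ; fromℕ<)
open import Data.Product using (Σ; _×_; ∃)
open import Data.Bool using (if_then_else_)
open import Function.Definitions using (Injective)
open import Relation.Binary.PropositionalEquality using (_≡_)
open import Relation.Nullary using (¬_)

-- A permutation of length n: an injective map from positions to values,
-- both in Fin n (0-based values 0..n-1; the paper uses 1..n, which is just a shift).
record Perm (n : ℕ) : Set where
  constructor perm
  field
    fun : Fin n → Fin n
    inj : Injective _≡_ _≡_ fun
open Perm public

Increasing : ∀ {k n} → (Fin k → Fin n) → Set
Increasing {k} e = ∀ (i j : Fin k) → toℕ i < toℕ j → toℕ (e i) < toℕ (e j)

Contains : ∀ {n k} → Perm n → Perm k → Set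
Contains {n} {k} π σ =
  Σ (Fin k → Fin n) λ e → Increasing e ×
    (∀ (i j : Fin k) → toℕ (fun σ i) < toℕ (fun σ j)
                     → toℕ (fun π (e i)) < toℕ (fun π (e j)))

Avoids : ∀ {n k} → Perm n → Perm k → Set
Avoids π σ = ¬ Contains π σ

Irreducible : ∀ {n} → Perm n → Set
Irreducible {n} π =
  ∀ (i : ℕ) (h : suc i < n) (h' : i < n) →
    ¬ (toℕ (fun π (fromℕ< h')) ≡ suc (toℕ (fun π (fromℕ< h))))

HasDecreasing : ∀ {n} → Perm n → ℕ → Set
HasDecreasing {n} π m =
  Σ (Fin m → Fin n) λ e → Increasing e ×
    (∀ (i j : Fin m) → toℕ i < toℕ j → toℕ (fun π (e j)) < toℕ (fun π (e i)))

α-fun : (r : ℕ) → Fin r → Fin r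
α-fun r i = i

α : (r : ℕ) → Perm r
α r = perm (α-fun r) (λ eq → eq)

-- β_pq = λ (q+1) (q+2) μ with λ = (p+q+2)...(q+3), μ = q ... 1.
-- 0-based values, s = p+q+2, position i:
--   i < p          ↦ s-1-i
--   i = p          ↦ q
--   i = p+1        ↦ q+1
--   i = p+2+j      ↦ q-1-j
β-val : ℕ → ℕ → ℕ → ℕ
β-val p q i =
  if i <ᵇ p then (p + q + 1) ∸ i
  else if i <ᵇ suc p then q
  else if i <ᵇ suc (suc p) then suc q
  else q ∸ suc (i ∸ (p + 2))

IsBeta : (p q : ℕ) → Perm (p + q + 2) → Set
IsBeta p q σ = ∀ (i : Fin (p + q + 2)) → toℕ (fun σ i) ≡ β-val p q (toℕ i)

module Submission where

-- Extend a decreasing subsequence D of π to a saturated one, with no point of π strictly between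
-- (in the south-east order ↘) two consecutive entries hi, lo.  Since π is irreducible, every such
-- gap has an escape w: in the vertical strip between hi and lo, above hi or below lo, or in the
-- horizontal band between them, left of hi or right of lo.  Let Λ and M be the first p and the
-- last q entries of D.  Within one of the four kinds, p + 1 (resp. q + 1) escapes forming a
-- decreasing subsequence would form β together with M (resp. Λ); and increasing subsequences of
-- escapes above and left of hi join through the last entry of Λ, those below and right of lo
-- through the first entry of M, into increasing subsequences of π, hence of length < r.  By Erdős–Szekeres the gaps
-- between Λ and M number at most (p + q)(r - 2), which bounds D; applying Erdős–Szekeres to π
-- itself then bounds n by (r - 1) times the longest decreasing subsequence.

open import Defs

open import Data.Bool using (true; false)
open import Data.Empty using (⊥)
open import Data.Fin using (Fin; toℕ; fromℕ<; punchOut; _≟_)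
open import Data.Fin.Properties
  using (toℕ-injective; toℕ-fromℕ<; fromℕ<-toℕ; toℕ<n; any?; punchOut-injective; injective⇒≤; pigeonhole)
open import Data.List
  using (List; []; _∷_; _++_; _∷ʳ_; length; filter; reverse; map; tabulate; initLast; _∷ʳ′_; take; drop; allFin)
open import Data.List.Properties
  using (length-++; length-map; length-reverse; length-tabulate; length-take; length-drop;
         unfold-reverse; filter-accept; take++drop≡id; ++-assoc)
open import Data.List.Membership.Propositional using (_∈_; find)
open import Data.List.Membership.Propositional.Properties using (∈-filter⁻; ∈-++⁻; ∈-++⁺ˡ; ∈-++⁺ʳ)
open import Data.List.Relation.Binary.Subset.Propositional using (_⊆_)
open import Data.List.Relation.Binary.Subset.Propositional.Properties using (filter-⊆; ∈-∷⁺ʳ)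
open import Data.List.Relation.Unary.All as All using (All; []; _∷_)
import Data.List.Relation.Unary.All.Properties as All
open import Data.List.Relation.Unary.AllPairs as AllPairs using (AllPairs; []; _∷_)
import Data.List.Relation.Unary.AllPairs.Properties as AllPairs
open import Data.List.Relation.Unary.Any using (here; there)
import Data.List.Relation.Unary.Any.Properties as Any
open import Data.List.Relation.Unary.Linked as Linked using (Linked; []; [-]; _∷_)
open import Data.List.Relation.Unary.Linked.Properties using (Linked⇒AllPairs)
open import Data.Nat using (ℕ; zero; suc; _+_; _*_; _∸_; _<_; _≤_; z≤n; s≤s; _<?_; _≤?_; _<ᵇ_)
open import Data.Nat.Properties hiding (_≟_)
open import Data.Nat.Properties using () renaming (_≟_ to _≟ℕ_)
open import Data.Nat.Tactic.RingSolver using (solve-∀)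
open import Data.Product using (∃-syntax; _×_; _,_; proj₁; proj₂; swap)
open import Data.Sum using (_⊎_; inj₁; inj₂; [_,_]′)
open import Function using (flip; _∘_; id)
open import Function.Definitions using (Injective)
open import Level using (0ℓ)
open import Relation.Binary using (Rel; Transitive; Asymmetric; Tri; tri<; tri≈; tri>)
open import Relation.Binary.Construct.Closure.Reflexive using (ReflClosure; refl; [_])
open import Relation.Binary.PropositionalEquality
open import Relation.Nullary using (¬_; Dec; yes; no; contradiction)
open import Relation.Nullary.Decidable using (_→-dec_; _×-dec_; _⊎-dec_; decidable-stable)
open import Relation.Unary using (Pred; Decidable)
open import Relation.Unary.Properties using (∁?)

-- The transposition of k and k + 1, by recursion on k so that lookupOr-swapAt holds by induction.
swapAt : ℕ → ℕ → ℕ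
swapAt zero    zero          = 1
swapAt zero    (suc zero)    = 0
swapAt zero    (suc (suc i)) = suc (suc i)
swapAt (suc k) zero          = zero
swapAt (suc k) (suc i)       = suc (swapAt k i)

swapAt-< : ∀ {k m i} → suc k < m → i < m → swapAt k i < m
swapAt-< {zero}  {suc zero}    {zero}   (s≤s ()) _
swapAt-< {zero}  {suc (suc m)} {zero}        _ _   = s≤s (s≤s z≤n)
swapAt-< {zero}  {suc m}       {suc zero}    _ _   = s≤s z≤n
swapAt-< {zero}  {_}           {suc (suc i)} _ i<m = i<m
swapAt-< {suc k} {suc m}       {zero}        _ _   = s≤s z≤n
swapAt-< {suc k} {suc m}       {suc i}  (s≤s k<m) (s≤s i<m) = s≤s (swapAt-< k<m i<m)

swapAt-self : ∀ k → swapAt k k ≡ suc k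
swapAt-self zero    = refl
swapAt-self (suc k) = cong suc (swapAt-self k)

swapAt-suc : ∀ k → swapAt k (suc k) ≡ k
swapAt-suc zero    = refl
swapAt-suc (suc k) = cong suc (swapAt-suc k)

swapAt-other : ∀ {k i} → i ≢ k → i ≢ suc k → swapAt k i ≡ i
swapAt-other {zero}  {zero}        i≢k _     = contradiction refl i≢k
swapAt-other {zero}  {suc zero}    _   i≢1+k = contradiction refl i≢1+k
swapAt-other {zero}  {suc (suc i)} _   _     = refl
swapAt-other {suc k} {zero}        _   _     = refl
swapAt-other {suc k} {suc i}       i≢k i≢1+k = cong suc (swapAt-other (i≢k ∘ cong suc) (i≢1+k ∘ cong suc))

module _ {A : Set} where

  length-filter-∁ : ∀ {ℓ} {P : Pred A ℓ} (P? : Decidable P) xs →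
                    length (filter P? xs) + length (filter (∁? P?) xs) ≡ length xs
  length-filter-∁ P? [] = refl
  length-filter-∁ P? (x ∷ xs) with P? x
  ... | yes _ = cong suc (length-filter-∁ P? xs)
  ... | no _  = trans (+-suc _ _) (cong suc (length-filter-∁ P? xs))

  length-filter-cover : ∀ {ℓ ℓ′} {P : Pred A ℓ} {Q : Pred A ℓ′} (P? : Decidable P) (Q? : Decidable Q) {xs} →
                        All (λ x → P x ⊎ Q x) xs → length xs ≤ length (filter P? xs) + length (filter Q? xs)
  length-filter-cover P? Q? {[]}     []             = z≤n
  length-filter-cover P? Q? {x ∷ xs} (Px⊎Qx ∷ PQxs) with P? x | Q? x | length-filter-cover P? Q? PQxs
  ... | yes _ | yes _ | ih = s≤s (≤-trans ih (+-monoʳ-≤ _ (n≤1+n _)))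
  ... | yes _ | no  _ | ih = s≤s ih
  ... | no  _ | yes _ | ih = ≤-trans (s≤s ih) (≤-reflexive (sym (+-suc _ _)))
  ... | no ¬P | no ¬Q | _  = contradiction Px⊎Qx [ ¬P , ¬Q ]′

  All-reverse⁺ : ∀ {ℓ} {P : Pred A ℓ} {xs} → All P xs → All P (reverse xs)
  All-reverse⁺ pxs = All.tabulate (All.lookup pxs ∘ Any.reverse⁻)

  module _ {ℓ} {R : Rel A ℓ} where

    AllPairs-++⁻ : ∀ xs {ys} → AllPairs R (xs ++ ys) →
                   AllPairs R xs × AllPairs R ys × All (λ x → All (R x) ys) xs
    AllPairs-++⁻ []       rys = [] , rys , []
    AllPairs-++⁻ (x ∷ xs) (rx ∷ rxs) with AllPairs-++⁻ xs rxs
    ... | rxs′ , rys , cross = All.++⁻ˡ xs rx ∷ rxs′ , rys , All.++⁻ʳ xs rx ∷ cross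

    AllPairs-reverse⁺ : ∀ {xs} → AllPairs R xs → AllPairs (flip R) (reverse xs)
    AllPairs-reverse⁺ {[]}     []         = []
    AllPairs-reverse⁺ {x ∷ xs} (rx ∷ rxs) rewrite unfold-reverse x xs =
      AllPairs.++⁺ (AllPairs-reverse⁺ rxs) ([] ∷ []) (All-reverse⁺ (All.map (_∷ []) rx))

    AllPairs-trichotomy : ∀ {xs x y} → AllPairs R xs → x ∈ xs → y ∈ xs → x ≡ y ⊎ R x y ⊎ R y x
    AllPairs-trichotomy (_  ∷ _)   (here refl) (here refl) = inj₁ refl
    AllPairs-trichotomy (rx ∷ _)   (here refl) (there y∈)  = inj₂ (inj₁ (All.lookup rx y∈))
    AllPairs-trichotomy (rx ∷ _)   (there x∈)  (here refl) = inj₂ (inj₂ (All.lookup rx x∈))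
    AllPairs-trichotomy (_  ∷ rxs) (there x∈)  (there y∈)  = AllPairs-trichotomy rxs x∈ y∈

    AllPairs-++-∷⁺ : Transitive R → ∀ {xs m ys} → AllPairs R xs → All (λ x → R x m) xs →
                     AllPairs R (m ∷ ys) → AllPairs R (xs ++ m ∷ ys)
    AllPairs-++-∷⁺ trans rxs xs<m rmys@(m<ys ∷ _) =
      AllPairs.++⁺ rxs rmys (All.map (λ x<m → x<m ∷ All.map (trans x<m) m<ys) xs<m)

    AllPairs-prefix : ∀ k {xs} → k ≤ length xs → AllPairs R xs →
                      ∃[ ys ] ys ⊆ xs × AllPairs R ys × length ys ≡ k
    AllPairs-prefix zero    _          _          = [] , (λ ()) , [] , refl
    AllPairs-prefix (suc k) {x ∷ xs} (s≤s k≤) (rx ∷ rxs) with AllPairs-prefix k k≤ rxs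
    ... | ys , ys⊆xs , rys , refl =
      x ∷ ys , ∈-∷⁺ʳ (here refl) (there ∘ ys⊆xs) , All.tabulate (All.lookup rx ∘ ys⊆xs) ∷ rys , refl

    ReflClosure-head : ∀ {x xs y} → AllPairs R (x ∷ xs) → y ∈ x ∷ xs → ReflClosure R x y
    ReflClosure-head _        (here refl) = refl
    ReflClosure-head (rx ∷ _) (there y∈)  = [ All.lookup rx y∈ ]

    ReflClosure-last : ∀ {xs z y} → AllPairs R (xs ∷ʳ z) → y ∈ xs ∷ʳ z → ReflClosure R y z
    ReflClosure-last {xs} rxsz y∈ with ∈-++⁻ xs y∈ | AllPairs-++⁻ xs rxsz
    ... | inj₁ y∈xs        | _ , _ , cross = [ All.head (All.lookup cross y∈xs) ]
    ... | inj₂ (here refl) | _             = refl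

    AllPairs-first : ∀ {xs} → 0 < length xs → AllPairs R xs → ∃[ z ] z ∈ xs × All (ReflClosure R z) xs
    AllPairs-first {x ∷ xs} _ (rx ∷ _) = x , here refl , refl ∷ All.map [_] rx

    AllPairs-last : ∀ {xs} → 0 < length xs → AllPairs R xs → ∃[ u ] u ∈ xs × All (λ y → ReflClosure R y u) xs
    AllPairs-last {x ∷ []}     _ _            = x , here refl , refl ∷ []
    AllPairs-last {x ∷ y ∷ xs} _ (rx ∷ ryxs) with u , u∈ , ⪯u ← AllPairs-last (s≤s z≤n) ryxs =
      u , there u∈ , [ All.lookup rx u∈ ] ∷ ⪯u

    AllPairs-reflects : ∀ {ℓ′} {K : Rel A ℓ′} {xs a b} → AllPairs R xs →
      (∀ {a b} → a ∈ xs → b ∈ xs → R a b → K a b) → Asymmetric K → a ∈ xs → b ∈ xs → K a b → R a b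
    AllPairs-reflects rxs R⇒K asym a∈ b∈ Kab with AllPairs-trichotomy rxs a∈ b∈
    ... | inj₁ refl        = contradiction Kab (asym Kab)
    ... | inj₂ (inj₁ Rab)  = Rab
    ... | inj₂ (inj₂ Rba)  = contradiction (R⇒K b∈ a∈ Rba) (asym Kab)

  AllPairs-map-under : ∀ {ℓ ℓ′ ℓ″} {P : Pred A ℓ} {R : Rel A ℓ′} {S : Rel A ℓ″} {xs} → All P xs →
    (∀ {a b} → P a → P b → R a b → S a b) → AllPairs R xs → AllPairs S xs
  AllPairs-map-under []         _   []         = []
  AllPairs-map-under (px ∷ pxs) R⇒S (rx ∷ rxs) =
    All.zipWith (λ (py , rxy) → R⇒S px py rxy) (pxs , rx) ∷ AllPairs-map-under pxs R⇒S rxs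

  Linked-++⁻ : ∀ {ℓ} {R : Rel A ℓ} xs {ys} → Linked R (xs ++ ys) → Linked R xs × Linked R ys
  Linked-++⁻ []           l           = [] , l
  Linked-++⁻ (x ∷ [])     l           = [-] , Linked.tail l
  Linked-++⁻ (x ∷ y ∷ xs) (Rxy ∷ l) with lxs , lys ← Linked-++⁻ (y ∷ xs) l = Rxy ∷ lxs , lys

  lookupOr : A → List A → ℕ → A
  lookupOr d []       _       = d
  lookupOr d (x ∷ xs) zero    = x
  lookupOr d (x ∷ xs) (suc i) = lookupOr d xs i

  All-lookupOr : ∀ {ℓ} {P : Pred A ℓ} {d xs i} → All P xs → i < length xs → P (lookupOr d xs i)
  All-lookupOr {i = zero}  (px ∷ _)   _        = px
  All-lookupOr {i = suc i} (_  ∷ pxs) (s≤s i<) = All-lookupOr pxs i<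

  AllPairs-lookupOr : ∀ {ℓ} {R : Rel A ℓ} {d xs i j} → AllPairs R xs → i < j → j < length xs →
                      R (lookupOr d xs i) (lookupOr d xs j)
  AllPairs-lookupOr {i = zero}  {suc j} (rx ∷ _)   _         (s≤s j<) = All-lookupOr rx j<
  AllPairs-lookupOr {i = suc i} {suc j} (_  ∷ rxs) (s≤s i<j) (s≤s j<) = AllPairs-lookupOr rxs i<j j<

  lookupOr-swapAt : ∀ d xs {a b ys} i →
    lookupOr d (xs ++ a ∷ b ∷ ys) (swapAt (length xs) i) ≡ lookupOr d (xs ++ b ∷ a ∷ ys) i
  lookupOr-swapAt d []       zero          = refl
  lookupOr-swapAt d []       (suc zero)    = refl
  lookupOr-swapAt d []       (suc (suc i)) = refl
  lookupOr-swapAt d (x ∷ xs) zero          = refl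
  lookupOr-swapAt d (x ∷ xs) (suc i)       = lookupOr-swapAt d xs i

module ErdősSzekeres {A : Set} (f g : A → ℕ) (g-injective : ∀ {a b} → g a ≡ g b → f a ≡ f b) where

  _⋱_ : Rel A 0ℓ
  a ⋱ b = f a < f b × g b < g a

  _⋰_ : Rel A 0ℓ
  a ⋰ b = f a < f b × g a < g b

  ⋰-trans : Transitive _⋰_
  ⋰-trans (f₁ , g₁) (f₂ , g₂) = <-trans f₁ f₂ , <-trans g₁ g₂

  private
    LeftMinimal : List A → A → Set
    LeftMinimal S h = All (λ y → f y < f h → g h < g y) S

    leftMinimal? : ∀ S → Decidable (LeftMinimal S)
    leftMinimal? S h = All.all? (λ y → (f y <? f h) →-dec (g h <? g y)) S

    minima-⋱ : ∀ {S xs} → xs ⊆ S → AllPairs (λ a b → f a < f b) xs → All (LeftMinimal S) xs →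
               AllPairs _⋱_ xs
    minima-⋱ xs⊆S []              []              = []
    minima-⋱ xs⊆S (x<xs ∷ sorted) (_ ∷ minimal) =
      All.zipWith (λ (x<y , y-min) → x<y , All.lookup y-min (xs⊆S (here refl)) x<y) (x<xs , minimal)
      ∷ minima-⋱ (xs⊆S ∘ there) sorted minimal

    ⋰-witness : ∀ {S h} → ¬ LeftMinimal S h → ∃[ y ] y ∈ S × y ⋰ h
    ⋰-witness {S} {h} ¬min with find (All.¬All⇒Any¬ (λ y → (f y <? f h) →-dec (g h <? g y)) S ¬min)
    ... | y , y∈S , ¬impl = y , y∈S , fy<fh , gy<gh
      where
      fy<fh : f y < f h
      fy<fh = decidable-stable (f y <? f h) (λ ¬lt → ¬impl (λ lt → contradiction lt ¬lt))
      gy<gh : g y < g h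
      gy<gh = ≤∧≢⇒< (≮⇒≥ (λ lt → ¬impl (λ _ → lt))) (λ eq → <-irrefl (g-injective eq) fy<fh)

  -- Peel off the left-to-right minima, which form a decreasing subsequence, and extend an
  -- increasing subsequence of the rest by a point below and to the left of its first element.
  increasing-subsequence : ∀ b S → AllPairs (λ x y → f x < f y) S →
    (∀ c → c ⊆ S → AllPairs _⋱_ c → length c ≢ suc b) →
    ∃[ c ] c ⊆ S × AllPairs _⋰_ c × length S ≤ b * length c
  increasing-subsequence b S = go (length S) S ≤-refl
    where
    go : ∀ k S → length S ≤ k → AllPairs (λ x y → f x < f y) S →
         (∀ c → c ⊆ S → AllPairs _⋱_ c → length c ≢ suc b) →
         ∃[ c ] c ⊆ S × AllPairs _⋰_ c × length S ≤ b * length c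
    go _       []      _        _      _  = [] , (λ ()) , [] , z≤n
    go (suc k) (h ∷ t) (s≤s |t|≤k) sorted no⋱ =
      extend (go k rest |rest|≤k (AllPairs.filter⁺ (∁? minimal?) sorted) no⋱-rest)
      where
      S′ = h ∷ t
      minimal? = leftMinimal? S′
      minima = filter minimal? S′
      rest = filter (∁? minimal?) S′
      h-minimal : LeftMinimal S′ h
      h-minimal = (λ h<h → contradiction h<h (<-irrefl refl))
                ∷ All.map (λ h<y y<h → contradiction h<y (<-asym y<h)) (AllPairs.head sorted)
      |minima|≤b : length minima ≤ b
      |minima|≤b with length minima ≤? b
      ... | yes ≤b = ≤b
      ... | no  ≰b with AllPairs-prefix (suc b) (≰⇒> ≰b)
                          (minima-⋱ (filter-⊆ minimal? S′) (AllPairs.filter⁺ minimal? sorted) (All.all-filter minimal? S′))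
      ...   | c , c⊆ , c⋱ , |c| = contradiction |c| (no⋱ c (filter-⊆ minimal? S′ ∘ c⊆) c⋱)
      |S′| : length minima + length rest ≡ length S′
      |S′| = length-filter-∁ minimal? S′
      |rest|≤k : length rest ≤ k
      |rest|≤k = +-cancelˡ-≤ 1 _ _ (begin
        1 + length rest             ≤⟨ +-monoˡ-≤ (length rest) (≤-trans (s≤s z≤n) (≤-reflexive
                                         (sym (cong length (filter-accept minimal? h-minimal))))) ⟩
        length minima + length rest ≡⟨ |S′| ⟩
        suc (length t)              ≤⟨ s≤s |t|≤k ⟩
        suc k                       ∎)
        where open ≤-Reasoning
      no⋱-rest : ∀ c → c ⊆ rest → AllPairs _⋱_ c → length c ≢ suc b
      no⋱-rest c c⊆ = no⋱ c (filter-⊆ (∁? minimal?) S′ ∘ c⊆)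
      |S′|≤ : ∀ c → length rest ≤ b * length c → length S′ ≤ b * suc (length c)
      |S′|≤ c bound = begin
        length S′                   ≡⟨ |S′| ⟨
        length minima + length rest ≤⟨ +-mono-≤ |minima|≤b bound ⟩
        b + b * length c            ≡⟨ *-suc b (length c) ⟨
        b * suc (length c)          ∎
        where open ≤-Reasoning
      extend : ∃[ c ] c ⊆ rest × AllPairs _⋰_ c × length rest ≤ b * length c →
               ∃[ c ] c ⊆ S′ × AllPairs _⋰_ c × length S′ ≤ b * length c
      extend ([] , _ , _ , bound) = h ∷ [] , (λ { (here refl) → here refl }) , [] ∷ [] , |S′|≤ [] bound
      extend (h′ ∷ c , c⊆ , h′⋰c ∷ ⋰c , bound)
        with y , y∈S′ , y⋰h′ ← ⋰-witness (proj₂ (∈-filter⁻ (∁? minimal?) (c⊆ (here refl)))) =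
        y ∷ h′ ∷ c , ∈-∷⁺ʳ y∈S′ (filter-⊆ (∁? minimal?) S′ ∘ c⊆) ,
        (y⋰h′ ∷ All.map (⋰-trans y⋰h′) h′⋰c) ∷ h′⋰c ∷ ⋰c , |S′|≤ (h′ ∷ c) bound

private
  q+[1+p]≡p+q+1 : ∀ p q → q + suc p ≡ p + q + 1
  q+[1+p]≡p+q+1 = solve-∀

  [1+q]+p≡p+q+1 : ∀ p q → suc q + p ≡ p + q + 1
  [1+q]+p≡p+q+1 = solve-∀

  q+[p+1]≡p+q+1 : ∀ p q → q + (p + 1) ≡ p + q + 1
  q+[p+1]≡p+q+1 = solve-∀

  p+q+2≡p+2+q : ∀ p q → p + q + 2 ≡ p + 2 + q
  p+q+2≡p+2+q = solve-∀

  a+[p+2+k]≡a+[1+k]+[p+1] : ∀ a p k → a + (p + 2 + k) ≡ a + suc k + (p + 1)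
  a+[p+2+k]≡a+[1+k]+[p+1] = solve-∀

  2+p≤p+2+k : ∀ p k → suc (suc p) ≤ p + 2 + k
  2+p≤p+2+k p k = ≤-trans (≤-reflexive (+-comm 2 p)) (m≤m+n (p + 2) k)

  p+[2+q]≡p+q+2 : ∀ p q → p + suc (suc q) ≡ p + q + 2
  p+[2+q]≡p+q+2 = solve-∀

  1+p<p+q+2 : ∀ p q → suc p < p + q + 2
  1+p<p+q+2 p q = ≤-trans (2+p≤p+2+k p q) (≤-reflexive (sym (p+q+2≡p+2+q p q)))

  +-suc-<⇒≤∸2 : ∀ {a b r} → a + suc b < r → a + b ≤ r ∸ 2
  +-suc-<⇒≤∸2 {a} {b} lt = ≤-trans (≤-reflexive (sym (m+n∸n≡m (a + b) 2)))
                                   (∸-monoˡ-≤ 2 (≤-trans (≤-reflexive (a+b+2≡1+a+[1+b] a b)) lt))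
    where
    a+b+2≡1+a+[1+b] : ∀ a b → a + b + 2 ≡ suc (a + suc b)
    a+b+2≡1+a+[1+b] = solve-∀

  *-monoʳ-≤-if-pos : ∀ k {a b} → (0 < k → a ≤ b) → k * a ≤ k * b
  *-monoʳ-≤-if-pos zero    _   = z≤n
  *-monoʳ-≤-if-pos (suc k) a≤b = *-monoʳ-≤ (suc k) (a≤b (s≤s z≤n))

  <⇒≤∸1 : ∀ {m n} → m < n → m ≤ n ∸ 1
  <⇒≤∸1 {n = suc n} (s≤s m≤n) = m≤n

  a+[1+m+b]≡a+b+[1+m] : ∀ a b m → a + (suc m + b) ≡ a + b + suc m
  a+[1+m+b]≡a+b+[1+m] = solve-∀

  <ᵇ-true : ∀ {m n} → m < n → (m <ᵇ n) ≡ true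
  <ᵇ-true {zero}  {suc n} _         = refl
  <ᵇ-true {suc m} {suc n} (s≤s m<n) = <ᵇ-true m<n

  <ᵇ-false : ∀ {m n} → n ≤ m → (m <ᵇ n) ≡ false
  <ᵇ-false {m}     {zero}  _         = refl
  <ᵇ-false {suc m} {suc n} (s≤s n≤m) = <ᵇ-false n≤m

module _ (p q : ℕ) where

  β-val-left : ∀ {i} → i < p → β-val p q i ≡ p + q + 1 ∸ i
  β-val-left i<p rewrite <ᵇ-true i<p = refl

  β-val-p : β-val p q p ≡ q
  β-val-p rewrite <ᵇ-false (≤-refl {p}) | <ᵇ-true (n<1+n p) = refl

  β-val-1+p : β-val p q (suc p) ≡ suc q
  β-val-1+p rewrite <ᵇ-false (n≤1+n p) | <ᵇ-false (≤-refl {suc p}) | <ᵇ-true (n<1+n (suc p)) = refl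

  β-val-right : ∀ k → β-val p q (p + 2 + k) ≡ q ∸ suc k
  β-val-right k
    rewrite <ᵇ-false (≤-trans (≤-trans (n≤1+n p) (n≤1+n (suc p))) (2+p≤p+2+k p k))
          | <ᵇ-false (≤-trans (n≤1+n (suc p)) (2+p≤p+2+k p k))
          | <ᵇ-false (2+p≤p+2+k p k)
          = cong (λ t → q ∸ suc t) (m+n∸m≡n (p + 2) k)

  private
    swapAt-right : ∀ k → swapAt p (p + 2 + k) ≡ p + 2 + k
    swapAt-right k = swapAt-other (λ eq → <-irrefl (sym eq) (≤-trans (n≤1+n _) (2+p≤p+2+k p k)))
                                  (λ eq → <-irrefl (sym eq) (2+p≤p+2+k p k))

  -- β_pq is the decreasing permutation with its entries at p and p + 1 exchanged.
  β-val+swapAt : ∀ {i} → i < p + q + 2 → β-val p q i + swapAt p i ≡ p + q + 1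
  β-val+swapAt {i} i<s with <-cmp i p
  ... | tri< i<p i≢p _ = begin
    β-val p q i + swapAt p i ≡⟨ cong₂ _+_ (β-val-left i<p) (swapAt-other i≢p (λ { refl → <-asym i<p (n<1+n p) })) ⟩
    p + q + 1 ∸ i + i        ≡⟨ m∸n+n≡m (≤-trans (<⇒≤ i<p) (≤-trans (m≤m+n p q) (m≤m+n (p + q) 1))) ⟩
    p + q + 1                ∎
    where open ≡-Reasoning
  ... | tri≈ _ refl _ = trans (cong₂ _+_ β-val-p (swapAt-self p)) (q+[1+p]≡p+q+1 p q)
  ... | tri> _ _ p<i with <-cmp i (suc p)
  ...   | tri< i<1+p _ _ = contradiction p<i (≤⇒≯ (≤-pred i<1+p))
  ...   | tri≈ _ refl _  = trans (cong₂ _+_ β-val-1+p (swapAt-suc p)) ([1+q]+p≡p+q+1 p q)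
  ...   | tri> _ _ 1+p<i = subst (λ i → β-val p q i + swapAt p i ≡ p + q + 1) (m+[n∸m]≡n p+2≤i) (begin
    β-val p q (p + 2 + k) + swapAt p (p + 2 + k) ≡⟨ cong₂ _+_ (β-val-right k) (swapAt-right k) ⟩
    (q ∸ suc k) + (p + 2 + k)                    ≡⟨ a+[p+2+k]≡a+[1+k]+[p+1] (q ∸ suc k) p k ⟩
    (q ∸ suc k) + suc k + (p + 1)                ≡⟨ cong (_+ (p + 1)) (m∸n+n≡m k<q) ⟩
    q + (p + 1)                                  ≡⟨ q+[p+1]≡p+q+1 p q ⟩
    p + q + 1                                    ∎)
    where
    open ≡-Reasoning
    p+2≤i : p + 2 ≤ i
    p+2≤i = ≤-trans (≤-reflexive (+-comm p 2)) 1+p<i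
    k = i ∸ (p + 2)
    k<q : k < q
    k<q = +-cancelˡ-< (p + 2) k q (subst₂ _<_ (sym (m+[n∸m]≡n p+2≤i)) (p+q+2≡p+2+q p q) i<s)

  β-inversion : ∀ {i j} → i < p + q + 2 → j < p + q + 2 →
                β-val p q i < β-val p q j → swapAt p j < swapAt p i
  β-inversion {i} {j} i<s j<s βi<βj = ≰⇒> λ τi≤τj → <-irrefl
    (trans (β-val+swapAt i<s) (sym (β-val+swapAt j<s))) (+-mono-<-≤ βi<βj τi≤τj)

injection-surjective : ∀ {m} {σ : Fin m → Fin m} → Injective _≡_ _≡_ σ → ∀ b → ∃[ a ] σ a ≡ b
injection-surjective {suc m} {σ} σ-injective b with any? (λ a → σ a ≟ b)
... | yes found  = found
... | no  missed = contradiction (injective⇒≤ squeezed-injective) (<-irrefl refl)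
  where
  squeezed : Fin (suc m) → Fin m
  squeezed a = punchOut {i = b} {j = σ a} (λ b≡σa → missed (a , sym b≡σa))
  squeezed-injective : Injective _≡_ _≡_ squeezed
  squeezed-injective eq = σ-injective (punchOut-injective {i = b} _ _ eq)

module Diagram {n : ℕ} (π : Perm n) where

  Point : Set
  Point = Fin n

  pos val : Point → ℕ
  pos = toℕ
  val a = toℕ (fun π a)

  val-injective : ∀ {a b} → val a ≡ val b → a ≡ b
  val-injective = inj π ∘ toℕ-injective

  infix 4 _↘_ _↗_ _⪯_ _⋖_

  _↘_ : Rel Point 0ℓ
  a ↘ b = pos a < pos b × val b < val a

  _↗_ : Rel Point 0ℓ
  a ↗ b = pos a < pos b × val a < val b

  ↘-trans : Transitive _↘_
  ↘-trans (pos₁ , val₁) (pos₂ , val₂) = <-trans pos₁ pos₂ , <-trans val₂ val₁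

  ↗-trans : Transitive _↗_
  ↗-trans (pos₁ , val₁) (pos₂ , val₂) = <-trans pos₁ pos₂ , <-trans val₁ val₂

  _⪯_ : Rel Point 0ℓ
  _⪯_ = ReflClosure _↘_

  ⪯-pos : ∀ {a b} → a ⪯ b → pos a ≤ pos b
  ⪯-pos refl    = ≤-refl
  ⪯-pos [ a↘b ] = <⇒≤ (proj₁ a↘b)

  ⪯-val : ∀ {a b} → a ⪯ b → val b ≤ val a
  ⪯-val refl    = ≤-refl
  ⪯-val [ a↘b ] = <⇒≤ (proj₂ a↘b)

  ⪯-↘-trans : ∀ {a b c} → a ⪯ b → b ↘ c → a ↘ c
  ⪯-↘-trans refl    b↘c = b↘c
  ⪯-↘-trans [ a↘b ] b↘c = ↘-trans a↘b b↘c

  ↘-⪯-trans : ∀ {a b c} → a ↘ b → b ⪯ c → a ↘ c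
  ↘-⪯-trans a↘b refl    = a↘b
  ↘-⪯-trans a↘b [ b↘c ] = ↘-trans a↘b b↘c

  ⪯⇒↘-pos : ∀ {a b} → a ⪯ b → pos a < pos b → a ↘ b
  ⪯⇒↘-pos refl    a<a = contradiction a<a (<-irrefl refl)
  ⪯⇒↘-pos [ a↘b ] _   = a↘b

  ⪯⇒↘-val : ∀ {a b} → a ⪯ b → val b < val a → a ↘ b
  ⪯⇒↘-val refl    a<a = contradiction a<a (<-irrefl refl)
  ⪯⇒↘-val [ a↘b ] _   = a↘b

  ↗-of-pos : ∀ {a b} → pos a < pos b → ¬ val b < val a → a ↗ b
  ↗-of-pos a<b b≮a = a<b , ≤∧≢⇒< (≮⇒≥ b≮a) (λ eq → <⇒≢ a<b (cong pos (val-injective eq)))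

  ↗-of-val : ∀ {a b} → val a < val b → ¬ pos b < pos a → a ↗ b
  ↗-of-val a<b b≮a = ≤∧≢⇒< (≮⇒≥ b≮a) (λ eq → <⇒≢ a<b (cong val (toℕ-injective eq))) , a<b

  _⋖_ : Rel Point 0ℓ
  a ⋖ b = a ↘ b × (∀ x → ¬ (a ↘ x × x ↘ b))

  Northwest Southeast : Point → Point → Point → Set
  Northwest x y l = pos l < pos x × val y < val l
  Southeast x y μ = pos y < pos μ × val μ < val x

  value-attained : ∀ {v} → v < n → ∃[ a ] val a ≡ v
  value-attained v<n with a , πa≡v ← injection-surjective (inj π) (fromℕ< v<n) =
    a , trans (cong toℕ πa≡v) (toℕ-fromℕ< v<n)

  ↘-chain-length : ∀ {c} → AllPairs _↘_ c → length c ≤ n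
  ↘-chain-length {[]}         _  = z≤n
  ↘-chain-length {c@(d ∷ _)} c↘ with length c ≤? n
  ... | yes ≤n = ≤n
  ... | no  ≰n with i , j , i<j , same ← pigeonhole (≰⇒> ≰n) (λ k → lookupOr d c (toℕ k)) =
    contradiction (cong pos same) (<⇒≢ (proj₁ (AllPairs-lookupOr c↘ i<j (toℕ<n j))))

  ↗-chain-length : ∀ {r c} → Avoids π (α r) → AllPairs _↗_ c → length c < r
  ↗-chain-length {zero}  {c}          avoids _  = contradiction ((λ ()) , (λ ()) , (λ ())) avoids
  ↗-chain-length {suc r} {[]}         _      _  = s≤s z≤n
  ↗-chain-length {suc r} {c@(d ∷ _)} avoids c↗ with length c <? suc r
  ... | yes <r = <r
  ... | no  ≮r = contradiction (e , (λ i j → proj₁ ∘ e↗ i j) , (λ i j → proj₂ ∘ e↗ i j)) avoids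
    where
    e : Fin (suc r) → Point
    e i = lookupOr d c (toℕ i)
    e↗ : ∀ i j → toℕ i < toℕ j → e i ↗ e j
    e↗ i j i<j = AllPairs-lookupOr c↗ i<j (<-≤-trans (toℕ<n j) (≮⇒≥ ≮r))

  HasDecreasing⇒chain : ∀ {m} → HasDecreasing π m → ∃[ c ] AllPairs _↘_ c × length c ≡ m
  HasDecreasing⇒chain (e , increasing , decreasing) =
    tabulate e , AllPairs.tabulate⁺-< (λ {i} {j} i<j → increasing i j i<j , decreasing i j i<j) , length-tabulate e

  module _ {p q} (β : Perm (p + q + 2)) (isβ : IsBeta p q β) where

    contains-β-of-swap : ∀ {Λ M x y} → length Λ ≡ p → length M ≡ q →
      AllPairs (λ a b → pos a < pos b) (Λ ++ x ∷ y ∷ M) →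
      AllPairs (λ a b → val b < val a) (Λ ++ y ∷ x ∷ M) → Contains π β
    contains-β-of-swap {Λ} {M} {x} {y} |Λ| |M| pos↑ val↓ = e , increasing , preserving
      where
      |L| : ∀ {a b} → length (Λ ++ a ∷ b ∷ M) ≡ p + q + 2
      |L| = trans (trans (length-++ Λ) (cong₂ (λ l m → l + suc (suc m)) |Λ| |M|)) (p+[2+q]≡p+q+2 p q)
      e : Fin (p + q + 2) → Point
      e i = lookupOr x (Λ ++ x ∷ y ∷ M) (toℕ i)
      increasing : Increasing e
      increasing i j i<j = AllPairs-lookupOr pos↑ i<j (subst (toℕ j <_) (sym |L|) (toℕ<n j))
      swapped : ∀ i → lookupOr x (Λ ++ y ∷ x ∷ M) (swapAt p (toℕ i)) ≡ e i
      swapped i = subst (λ k → lookupOr x (Λ ++ y ∷ x ∷ M) (swapAt k (toℕ i)) ≡ e i) |Λ|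
                        (lookupOr-swapAt x Λ (toℕ i))
      preserving : ∀ i j → toℕ (fun β i) < toℕ (fun β j) → val (e i) < val (e j)
      preserving i j βi<βj = subst₂ (λ a b → val a < val b) (swapped i) (swapped j)
        (AllPairs-lookupOr val↓ (β-inversion p q (toℕ<n i) (toℕ<n j) (subst₂ _<_ (isβ i) (isβ j) βi<βj))
          (subst (_ <_) (sym |L|) (swapAt-< (1+p<p+q+2 p q) (toℕ<n i))))

    contains-β : ∀ {Λ M x y} → length Λ ≡ p → length M ≡ q → AllPairs _↘_ Λ → AllPairs _↘_ M →
      All (Northwest x y) Λ → x ↗ y → All (Southeast x y) M → Contains π β
    contains-β |Λ| |M| Λ↘ M↘ Λ◸ (x<y , vx<vy) M◿ = contains-β-of-swap |Λ| |M|
      (AllPairs-++-∷⁺ <-trans (AllPairs.map proj₁ Λ↘) (All.map proj₁ Λ◸)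
        ((x<y ∷ All.map (<-trans x<y ∘ proj₁) M◿) ∷ All.map proj₁ M◿ ∷ AllPairs.map proj₁ M↘))
      (AllPairs-++-∷⁺ (flip <-trans) (AllPairs.map proj₂ Λ↘) (All.map proj₂ Λ◸)
        ((vx<vy ∷ All.map ((λ vμ<vx → <-trans vμ<vx vx<vy) ∘ proj₂) M◿)
         ∷ All.map proj₂ M◿ ∷ AllPairs.map proj₂ M↘))

  _↘?_ : ∀ a b → Dec (a ↘ b)
  a ↘? b = (pos a <? pos b) ×-dec (val b <? val a)

  _↗?_ : ∀ a b → Dec (a ↗ b)
  a ↗? b = (pos a <? pos b) ×-dec (val a <? val b)

  Refinement : List Point → Set
  Refinement D = ∃[ D′ ] AllPairs _↘_ D′ × length D′ ≡ suc (length D)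
                         × (∀ {a} → All (a ↘_) D → All (a ↘_) D′)

  saturated-or-refinable : ∀ {D} → AllPairs _↘_ D → Linked _⋖_ D ⊎ Refinement D
  saturated-or-refinable {[]}         _ = inj₁ []
  saturated-or-refinable {x ∷ []}     _ = inj₁ [-]
  saturated-or-refinable {x ∷ y ∷ D} (x↘ ∷ y↘D) with any? (λ z → (x ↘? z) ×-dec (z ↘? y))
  ... | yes (z , x↘z , z↘y) =
    inj₂ (x ∷ z ∷ y ∷ D , (x↘z ∷ x↘) ∷ (z↘y ∷ All.map (↘-trans z↘y) (AllPairs.head y↘D)) ∷ y↘D ,
          refl , λ { (a↘x ∷ a↘) → a↘x ∷ ↘-trans a↘x x↘z ∷ a↘ })
  ... | no  nothing-between with saturated-or-refinable y↘D
  ...   | inj₁ linked = inj₁ ((All.head x↘ , λ z → nothing-between ∘ (z ,_)) ∷ linked)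
  ...   | inj₂ (D′ , D′↘ , |D′| , extends) =
    inj₂ (x ∷ D′ , extends x↘ ∷ D′↘ , cong suc |D′| , λ { (a↘x ∷ a↘) → a↘x ∷ extends a↘ })

  saturate : ∀ {D} → AllPairs _↘_ D → ∃[ D′ ] Linked _⋖_ D′ × length D ≤ length D′
  saturate = go n (m≤m+n n _)
    where
    go : ∀ k {D} → n ≤ k + length D → AllPairs _↘_ D → ∃[ D′ ] Linked _⋖_ D′ × length D ≤ length D′
    go k n≤ D↘ with saturated-or-refinable D↘
    go k       n≤ D↘ | inj₁ linked = _ , linked , ≤-refl
    go zero    n≤ D↘ | inj₂ (D′ , D′↘ , |D′| , _) =
      contradiction (≤-trans (subst (_≤ n) |D′| (↘-chain-length D′↘)) n≤) (<-irrefl refl)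
    go (suc k) {D} n≤ D↘ | inj₂ (D′ , D′↘ , |D′| , _)
      with D″ , linked , |D′|≤ ← go k (subst (λ m → n ≤ k + m) (sym |D′|) (≤-trans n≤ (≤-reflexive (sym (+-suc k _))))) D′↘ =
      D″ , linked , ≤-trans (n≤1+n _) (subst (_≤ length D″) |D′| |D′|≤)

  AboveHi LeftOfHi BelowLo RightOfLo Escape : Point → Point → Point → Set
  AboveHi   hi lo w = hi ↗ w × pos w < pos lo
  LeftOfHi  hi lo w = w ↗ hi × val lo < val w
  BelowLo   hi lo w = w ↗ lo × pos hi < pos w
  RightOfLo hi lo w = lo ↗ w × val w < val hi
  Escape    hi lo w = (AboveHi hi lo w ⊎ LeftOfHi hi lo w) ⊎ (BelowLo hi lo w ⊎ RightOfLo hi lo w)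

  module _ (irreducible : Irreducible π) where

    adjacent-not-consecutive : ∀ {a b} → pos b ≡ suc (pos a) → val a ≢ suc (val b)
    adjacent-not-consecutive {a} {b} b≡a+1 = subst₂ (λ a′ b′ → val a′ ≢ suc (val b′))
      (fromℕ<-toℕ a (toℕ<n a)) (toℕ-injective (trans (toℕ-fromℕ< a+1<n) (sym b≡a+1)))
      (irreducible (pos a) a+1<n (toℕ<n a))
      where
      a+1<n : suc (pos a) < n
      a+1<n = subst (_< n) b≡a+1 (toℕ<n b)

    escape-strip : ∀ {hi lo} → hi ⋖ lo → suc (pos hi) < pos lo → ∃[ w ] Escape hi lo w
    escape-strip {hi} {lo} (_ , nothing-between) hi+1<lo =
      w , classify (<-cmp (val hi) (val w)) (<-cmp (val w) (val lo))
      where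
      w<n : suc (pos hi) < n
      w<n = <-trans hi+1<lo (toℕ<n lo)
      w : Point
      w = fromℕ< w<n
      hi<w : pos hi < pos w
      hi<w = subst (pos hi <_) (sym (toℕ-fromℕ< w<n)) (n<1+n (pos hi))
      w<lo : pos w < pos lo
      w<lo = subst (_< pos lo) (sym (toℕ-fromℕ< w<n)) hi+1<lo
      classify : Tri (val hi < val w) _ _ → Tri (val w < val lo) _ _ → Escape hi lo w
      classify (tri< hi<w′ _ _) _                 = inj₁ (inj₁ ((hi<w , hi<w′) , w<lo))
      classify (tri≈ _ hi≡w _)  _                 = contradiction (cong pos (val-injective hi≡w)) (<⇒≢ hi<w)
      classify (tri> _ _ w<hi)  (tri< w<lo′ _ _)  = inj₂ (inj₁ ((w<lo , w<lo′) , hi<w))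
      classify (tri> _ _ _)     (tri≈ _ w≡lo _)   = contradiction (cong pos (val-injective w≡lo)) (<⇒≢ w<lo)
      classify (tri> _ _ w<hi)  (tri> _ _ lo<w)   = contradiction ((hi<w , w<hi) , (w<lo , lo<w)) (nothing-between w)

    escape-band : ∀ {hi lo} → pos lo ≡ suc (pos hi) → suc (val lo) < val hi → ∃[ w ] Escape hi lo w
    escape-band {hi} {lo} lo≡hi+1 lo+1<hi = w , classify (<-cmp (pos w) (pos hi)) (<-cmp (pos lo) (pos w))
      where
      attained = value-attained (<-trans lo+1<hi (toℕ<n (fun π hi)))
      w : Point
      w = proj₁ attained
      lo<w : val lo < val w
      lo<w = subst (val lo <_) (sym (proj₂ attained)) (n<1+n (val lo))
      w<hi : val w < val hi
      w<hi = subst (_< val hi) (sym (proj₂ attained)) lo+1<hi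
      classify : Tri (pos w < pos hi) _ _ → Tri (pos lo < pos w) _ _ → Escape hi lo w
      classify (tri< w<hi′ _ _) _                = inj₁ (inj₂ ((w<hi′ , w<hi) , lo<w))
      classify (tri≈ _ w≡hi _)  _                = contradiction (cong val (toℕ-injective w≡hi)) (<⇒≢ w<hi)
      classify (tri> _ _ hi<w′) (tri< lo<w′ _ _) = inj₂ (inj₂ ((lo<w′ , lo<w) , w<hi))
      classify (tri> _ _ _)     (tri≈ _ lo≡w _)  = contradiction (cong val (toℕ-injective lo≡w)) (<⇒≢ lo<w)
      classify (tri> _ _ hi<w′) (tri> _ _ w<lo′) =
        contradiction (≤-pred (subst (pos w <_) lo≡hi+1 w<lo′)) (<⇒≱ hi<w′)

    -- Either a point sits in the vertical strip strictly between hi and lo, or they are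
    -- adjacent and, π being irreducible, the value val lo + 1 sits outside that strip.
    escape : ∀ {hi lo} → hi ⋖ lo → ∃[ w ] Escape hi lo w
    escape {hi} {lo} hi⋖lo@((hi<lo , lo<hi) , _) with pos lo ≟ℕ suc (pos hi)
    ... | no  lo≢hi+1 = escape-strip hi⋖lo (≤∧≢⇒< hi<lo (lo≢hi+1 ∘ sym))
    ... | yes lo≡hi+1 = escape-band lo≡hi+1 (≤∧≢⇒< lo<hi (adjacent-not-consecutive lo≡hi+1 ∘ sym))

  left-block : ∀ k {A S} → length A ≡ k ∸ 1 → 0 < length S → AllPairs _↘_ (A ++ S) →
               ∃[ Λ ] length Λ ≡ k × AllPairs _↘_ Λ × All (λ s → All (_⪯ s) Λ) S
  left-block zero              _   _ _   = [] , refl , [] , All.tabulate λ _ → []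
  left-block (suc k) {A} {s ∷ S} |A| _ AS↘ with A↘ , sS↘ , A↘sS ← AllPairs-++⁻ A AS↘ =
    A ∷ʳ s , trans (length-++ A) (trans (+-comm _ 1) (cong suc |A|)) ,
    AllPairs.++⁺ A↘ ([] ∷ []) (All.map (λ a↘ → All.head a↘ ∷ []) A↘sS) ,
    All.tabulate λ t∈ → All.++⁺ (All.map (λ a↘ → [ All.lookup a↘ t∈ ]) A↘sS) (ReflClosure-head sS↘ t∈ ∷ [])

  right-block : ∀ k {S B} → length B ≡ k ∸ 1 → 0 < length S → AllPairs _↘_ (S ++ B) →
                ∃[ M ] length M ≡ k × AllPairs _↘_ M × All (λ s → All (s ⪯_) M) S
  right-block zero    _   _   _ = [] , refl , [] , All.tabulate λ _ → []
  right-block (suc k) {S} {B} |B| 0<S SB↘ with initLast S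
  ... | []        = contradiction 0<S λ ()
  ... | S′ ∷ʳ′ z with S↘ , B↘ , S↘B ← AllPairs-++⁻ (S′ ∷ʳ z) SB↘ =
    z ∷ B , cong suc |B| , All.lookup S↘B (∈-++⁺ʳ S′ (here refl)) ∷ B↘ ,
    All.tabulate λ t∈ → ReflClosure-last S↘ t∈ ∷ All.map [_] (All.lookup S↘B t∈)

module Gaps {n} (π : Perm n) {r p q : ℕ} (β : Perm (p + q + 2)) (isβ : IsBeta p q β)
             (avoids-α : Avoids π (α r)) (avoids-β : Avoids π β)
             (Λ M : List (Fin n)) (|Λ| : length Λ ≡ p) (|M| : length M ≡ q)
             (Λ↘ : AllPairs (Diagram._↘_ π) Λ) (M↘ : AllPairs (Diagram._↘_ π) M) where

  open Diagram π

  record Gap : Set where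
    field
      hi lo w : Point
      hi↘lo   : hi ↘ lo
      Λ⪯hi    : All (_⪯ hi) Λ
      lo⪯M    : All (lo ⪯_) M
      escapes : Escape hi lo w
  open Gap

  Before : Rel Gap 0ℓ
  Before g g′ = lo g ⪯ hi g′

  IsAboveHi IsLeftOfHi IsBelowLo IsRightOfLo : Gap → Set
  IsAboveHi   g = AboveHi   (hi g) (lo g) (w g)
  IsLeftOfHi  g = LeftOfHi  (hi g) (lo g) (w g)
  IsBelowLo   g = BelowLo   (hi g) (lo g) (w g)
  IsRightOfLo g = RightOfLo (hi g) (lo g) (w g)

  isAboveHi? : Decidable IsAboveHi
  isAboveHi? g = (hi g ↗? w g) ×-dec (pos (w g) <? pos (lo g))

  isLeftOfHi? : Decidable IsLeftOfHi
  isLeftOfHi? g = (w g ↗? hi g) ×-dec (val (lo g) <? val (w g))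

  isBelowLo? : Decidable IsBelowLo
  isBelowLo? g = (w g ↗? lo g) ×-dec (pos (hi g) <? pos (w g))

  isRightOfLo? : Decidable IsRightOfLo
  isRightOfLo? g = (lo g ↗? w g) ×-dec (val (w g) <? val (hi g))

  M-fits-above : ∀ g → IsAboveHi g → All (Southeast (hi g) (w g)) M
  M-fits-above g (_ , w<lo) =
    All.map (λ lo⪯μ → <-≤-trans w<lo (⪯-pos lo⪯μ) , proj₂ (↘-⪯-trans (hi↘lo g) lo⪯μ)) (lo⪯M g)

  M-fits-left : ∀ g → IsLeftOfHi g → All (Southeast (w g) (hi g)) M
  M-fits-left g (_ , lo<w) =
    All.map (λ lo⪯μ → proj₁ (↘-⪯-trans (hi↘lo g) lo⪯μ) , ≤-<-trans (⪯-val lo⪯μ) lo<w) (lo⪯M g)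

  Λ-fits-below : ∀ g → IsBelowLo g → All (Northwest (w g) (lo g)) Λ
  Λ-fits-below g (_ , hi<w) =
    All.map (λ l⪯hi → ≤-<-trans (⪯-pos l⪯hi) hi<w , proj₂ (⪯-↘-trans l⪯hi (hi↘lo g))) (Λ⪯hi g)

  Λ-fits-right : ∀ g → IsRightOfLo g → All (Northwest (lo g) (w g)) Λ
  Λ-fits-right g (_ , w<hi) =
    All.map (λ l⪯hi → proj₁ (⪯-↘-trans l⪯hi (hi↘lo g)) , <-≤-trans w<hi (⪯-val l⪯hi)) (Λ⪯hi g)

  no-β : ∀ {Λ′ M′ x y} → length Λ′ ≡ p → length M′ ≡ q → AllPairs _↘_ Λ′ → AllPairs _↘_ M′ →
         All (Northwest x y) Λ′ → x ↗ y → All (Southeast x y) M′ → ⊥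
  no-β |Λ′| |M′| Λ′↘ M′↘ Λ′-fits x↗y M′-fits =
    avoids-β (contains-β β isβ |Λ′| |M′| Λ′↘ M′↘ Λ′-fits x↗y M′-fits)

  module HiPivot {u} (u∈Λ : u ∈ Λ) (Λ⪯u : All (_⪯ u) Λ) where

    u⪯hi : ∀ g → u ⪯ hi g
    u⪯hi g = All.lookup (Λ⪯hi g) u∈Λ

    u↗above : ∀ g → IsAboveHi g → u ↗ w g
    u↗above g above@(hi↗w@(hi<w , hi<w′) , _) = ↗-of-pos (≤-<-trans (⪯-pos (u⪯hi g)) hi<w) λ w<u →
      no-β |Λ| |M| Λ↘ M↘ (All.zipWith (fits w<u) (Λ⪯hi g , Λ⪯u)) hi↗w (M-fits-above g above)
      where
      fits : val (w g) < val u → ∀ {l} → l ⪯ hi g × l ⪯ u → Northwest (hi g) (w g) l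
      fits w<u (l⪯hi , l⪯u) = proj₁ (⪯⇒↘-val l⪯hi (<-trans hi<w′ w<l)) , w<l
        where w<l = <-≤-trans w<u (⪯-val l⪯u)

    left↗u : ∀ g → IsLeftOfHi g → w g ↗ u
    left↗u g left@(w↗hi@(w<hi , w<hi′) , _) = ↗-of-val (<-≤-trans w<hi′ (⪯-val (u⪯hi g))) λ u<w →
      no-β |Λ| |M| Λ↘ M↘ (All.zipWith (fits u<w) (Λ⪯hi g , Λ⪯u)) w↗hi (M-fits-left g left)
      where
      fits : pos u < pos (w g) → ∀ {l} → l ⪯ hi g × l ⪯ u → Northwest (w g) (hi g) l
      fits u<w (l⪯hi , l⪯u) = l<w , proj₂ (⪯⇒↘-pos l⪯hi (<-trans l<w w<hi))
        where l<w = ≤-<-trans (⪯-pos l⪯u) u<w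

  module LoPivot {z} (z∈M : z ∈ M) (z⪯M : All (z ⪯_) M) where

    lo⪯z : ∀ g → lo g ⪯ z
    lo⪯z g = All.lookup (lo⪯M g) z∈M

    below↗z : ∀ g → IsBelowLo g → w g ↗ z
    below↗z g below@(w↗lo@(w<lo , w<lo′) , _) = ↗-of-pos (<-≤-trans w<lo (⪯-pos (lo⪯z g))) λ z<w →
      no-β |Λ| |M| Λ↘ M↘ (Λ-fits-below g below) w↗lo (All.zipWith (fits z<w) (lo⪯M g , z⪯M))
      where
      fits : val z < val (w g) → ∀ {μ} → lo g ⪯ μ × z ⪯ μ → Southeast (w g) (lo g) μ
      fits z<w (lo⪯μ , z⪯μ) = proj₁ (⪯⇒↘-val lo⪯μ (<-trans μ<w w<lo′)) , μ<w
        where μ<w = ≤-<-trans (⪯-val z⪯μ) z<w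

    z↗right : ∀ g → IsRightOfLo g → z ↗ w g
    z↗right g right@(lo↗w@(lo<w , lo<w′) , _) = ↗-of-val (≤-<-trans (⪯-val (lo⪯z g)) lo<w′) λ w<z →
      no-β |Λ| |M| Λ↘ M↘ (Λ-fits-right g right) lo↗w (All.zipWith (fits w<z) (lo⪯M g , z⪯M))
      where
      fits : pos (w g) < pos z → ∀ {μ} → lo g ⪯ μ × z ⪯ μ → Southeast (lo g) (w g) μ
      fits w<z (lo⪯μ , z⪯μ) = w<μ , proj₂ (⪯⇒↘-pos lo⪯μ (<-trans lo<w w<μ))
        where w<μ = <-≤-trans w<z (⪯-pos z⪯μ)

  module AboveFamily {T} (T-before : AllPairs Before T) (T-above : All IsAboveHi T) where
    open ErdősSzekeres (pos ∘ w) (val ∘ w) (cong pos ∘ val-injective) public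

    before⇒left : ∀ {a b} → IsAboveHi a → IsAboveHi b → Before a b → pos (w a) < pos (w b)
    before⇒left (_ , a<lo) ((hi<b , _) , _) lo⪯hi = <-trans (<-≤-trans a<lo (⪯-pos lo⪯hi)) hi<b

    left⇒before : ∀ {a b} → a ∈ T → b ∈ T → pos (w a) < pos (w b) → Before a b
    left⇒before = AllPairs-reflects {K = λ a b → pos (w a) < pos (w b)} T-before
      (λ {a} {b} a∈ b∈ → before⇒left {a} {b} (All.lookup T-above a∈) (All.lookup T-above b∈)) <-asym

    no-long-⋱ : ∀ c → c ⊆ T → AllPairs _⋱_ c → length c ≢ suc p
    no-long-⋱ c c⊆T c⋱ |c| with initLast c
    ... | []       = 1+n≢0 (sym |c|)
    ... | c₀ ∷ʳ′ t = no-β |Λ′| |M| (AllPairs.map⁺ c₀⋱) M↘ Λ′-fits (proj₁ t-above) (M-fits-above t t-above)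
      where
      t∈T = c⊆T (∈-++⁺ʳ c₀ (here refl))
      t-above = All.lookup T-above t∈T
      c₀⋱ = proj₁ (AllPairs-++⁻ c₀ c⋱)
      c₀⋱t = proj₂ (proj₂ (AllPairs-++⁻ c₀ c⋱))
      |Λ′| : length (map w c₀) ≡ p
      |Λ′| = trans (length-map w c₀) (suc-injective (trans (+-comm 1 _) (trans (sym (length-++ c₀)) |c|)))
      fits : ∀ {a} → a ∈ c₀ → Northwest (hi t) (w t) (w a)
      fits a∈ = <-≤-trans (proj₂ (All.lookup T-above a∈T)) (⪯-pos (left⇒before a∈T t∈T (proj₁ a⋱t)))
              , proj₂ a⋱t
        where
        a∈T = c⊆T (∈-++⁺ˡ a∈)
        a⋱t = All.head (All.lookup c₀⋱t a∈)
      Λ′-fits : All (Northwest (hi t) (w t)) (map w c₀)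
      Λ′-fits = All.map⁺ (All.tabulate fits)

    chain : ∃[ c ] c ⊆ T × AllPairs _⋰_ c × length T ≤ p * length c
    chain = increasing-subsequence p T (AllPairs-map-under T-above (λ {a} {b} → before⇒left {a} {b}) T-before) no-long-⋱

  module LeftFamily {L} (L-before : AllPairs Before L) (L-left : All IsLeftOfHi L) where
    open ErdősSzekeres (val ∘ w) (pos ∘ w) (cong val ∘ toℕ-injective) public

    before⇒above : ∀ {a b} → IsLeftOfHi a → IsLeftOfHi b → Before a b → val (w b) < val (w a)
    before⇒above (_ , lo<a) ((_ , b<hi) , _) lo⪯hi = <-trans (<-≤-trans b<hi (⪯-val lo⪯hi)) lo<a

    above⇒before : ∀ {a b} → a ∈ L → b ∈ L → val (w b) < val (w a) → Before a b
    above⇒before = AllPairs-reflects {K = λ a b → val (w b) < val (w a)} L-before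
      (λ {a} {b} a∈ b∈ → before⇒above {a} {b} (All.lookup L-left a∈) (All.lookup L-left b∈)) <-asym

    no-long-⋱ : ∀ c → c ⊆ reverse L → AllPairs _⋱_ c → length c ≢ suc p
    no-long-⋱ []       _  _                 ()
    no-long-⋱ (t ∷ c₀) c⊆ (t⋱c₀ ∷ c₀⋱) |c| =
      no-β |Λ′| |M| Λ′↘ M↘ Λ′-fits (proj₁ t-left) (M-fits-left t t-left)
      where
      ∈L : ∀ {a} → a ∈ t ∷ c₀ → a ∈ L
      ∈L = Any.reverse⁻ ∘ c⊆
      t-left = All.lookup L-left (∈L (here refl))
      |Λ′| : length (reverse (map w c₀)) ≡ p
      |Λ′| = trans (length-reverse (map w c₀)) (trans (length-map w c₀) (suc-injective |c|))
      Λ′↘ : AllPairs _↘_ (reverse (map w c₀))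
      Λ′↘ = AllPairs-reverse⁺ (AllPairs.map⁺ (AllPairs.map swap c₀⋱))
      fits : ∀ {a} → a ∈ c₀ → Northwest (w t) (hi t) (w a)
      fits a∈ = proj₂ t⋱a , ≤-<-trans (⪯-val (above⇒before a∈L (∈L (here refl)) (proj₁ t⋱a)))
                                      (proj₂ (All.lookup L-left a∈L))
        where
        a∈L = ∈L (there a∈)
        t⋱a = All.lookup t⋱c₀ a∈
      Λ′-fits : All (Northwest (w t) (hi t)) (reverse (map w c₀))
      Λ′-fits = All-reverse⁺ (All.map⁺ (All.tabulate fits))

    chain : ∃[ c ] c ⊆ reverse L × AllPairs _⋰_ c × length (reverse L) ≤ p * length c
    chain = increasing-subsequence p (reverse L)
      (AllPairs-reverse⁺ (AllPairs-map-under {S = λ a b → val (w b) < val (w a)} L-left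
                            (λ {a} {b} → before⇒above {a} {b}) L-before))
      no-long-⋱

  module BelowFamily {B} (B-before : AllPairs Before B) (B-below : All IsBelowLo B) where
    open ErdősSzekeres (pos ∘ w) (val ∘ w) (cong pos ∘ val-injective) public

    before⇒left : ∀ {a b} → IsBelowLo a → IsBelowLo b → Before a b → pos (w a) < pos (w b)
    before⇒left ((a<lo , _) , _) (_ , hi<b) lo⪯hi = <-trans (<-≤-trans a<lo (⪯-pos lo⪯hi)) hi<b

    left⇒before : ∀ {a b} → a ∈ B → b ∈ B → pos (w a) < pos (w b) → Before a b
    left⇒before = AllPairs-reflects {K = λ a b → pos (w a) < pos (w b)} B-before
      (λ {a} {b} a∈ b∈ → before⇒left {a} {b} (All.lookup B-below a∈) (All.lookup B-below b∈)) <-asym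

    no-long-⋱ : ∀ c → c ⊆ B → AllPairs _⋱_ c → length c ≢ suc q
    no-long-⋱ []       _  _                 ()
    no-long-⋱ (t ∷ c₀) c⊆ (t⋱c₀ ∷ c₀⋱) |c| =
      no-β |Λ| |M′| Λ↘ (AllPairs.map⁺ c₀⋱) (Λ-fits-below t t-below) (proj₁ t-below) M′-fits
      where
      t∈B = c⊆ (here refl)
      t-below = All.lookup B-below t∈B
      |M′| : length (map w c₀) ≡ q
      |M′| = trans (length-map w c₀) (suc-injective |c|)
      fits : ∀ {a} → a ∈ c₀ → Southeast (w t) (lo t) (w a)
      fits a∈ = ≤-<-trans (⪯-pos (left⇒before t∈B a∈B (proj₁ t⋱a))) (proj₂ (All.lookup B-below a∈B))
              , proj₂ t⋱a
        where
        a∈B = c⊆ (there a∈)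
        t⋱a = All.lookup t⋱c₀ a∈
      M′-fits : All (Southeast (w t) (lo t)) (map w c₀)
      M′-fits = All.map⁺ (All.tabulate fits)

    chain : ∃[ c ] c ⊆ B × AllPairs _⋰_ c × length B ≤ q * length c
    chain = increasing-subsequence q B (AllPairs-map-under B-below (λ {a} {b} → before⇒left {a} {b}) B-before) no-long-⋱

  module RightFamily {R} (R-before : AllPairs Before R) (R-right : All IsRightOfLo R) where
    open ErdősSzekeres (val ∘ w) (pos ∘ w) (cong val ∘ toℕ-injective) public

    before⇒above : ∀ {a b} → IsRightOfLo a → IsRightOfLo b → Before a b → val (w b) < val (w a)
    before⇒above ((_ , lo<a) , _) (_ , b<hi) lo⪯hi = <-trans (<-≤-trans b<hi (⪯-val lo⪯hi)) lo<a

    above⇒before : ∀ {a b} → a ∈ R → b ∈ R → val (w b) < val (w a) → Before a b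
    above⇒before = AllPairs-reflects {K = λ a b → val (w b) < val (w a)} R-before
      (λ {a} {b} a∈ b∈ → before⇒above {a} {b} (All.lookup R-right a∈) (All.lookup R-right b∈)) <-asym

    no-long-⋱ : ∀ c → c ⊆ reverse R → AllPairs _⋱_ c → length c ≢ suc q
    no-long-⋱ c c⊆ c⋱ |c| with initLast c
    ... | []       = 1+n≢0 (sym |c|)
    ... | c₀ ∷ʳ′ t = no-β |Λ| |M′| Λ↘ M′↘ (Λ-fits-right t t-right) (proj₁ t-right) M′-fits
      where
      ∈R : ∀ {a} → a ∈ c₀ ∷ʳ t → a ∈ R
      ∈R = Any.reverse⁻ ∘ c⊆
      t∈R = ∈R (∈-++⁺ʳ c₀ (here refl))
      t-right = All.lookup R-right t∈R
      c₀⋱ = proj₁ (AllPairs-++⁻ c₀ c⋱)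
      c₀⋱t = proj₂ (proj₂ (AllPairs-++⁻ c₀ c⋱))
      |M′| : length (reverse (map w c₀)) ≡ q
      |M′| = trans (length-reverse (map w c₀)) (trans (length-map w c₀)
               (suc-injective (trans (+-comm 1 _) (trans (sym (length-++ c₀)) |c|))))
      M′↘ : AllPairs _↘_ (reverse (map w c₀))
      M′↘ = AllPairs-reverse⁺ (AllPairs.map⁺ (AllPairs.map swap c₀⋱))
      fits : ∀ {a} → a ∈ c₀ → Southeast (lo t) (w t) (w a)
      fits a∈ = proj₂ a⋱t
              , <-≤-trans (proj₂ (All.lookup R-right a∈R)) (⪯-val (above⇒before t∈R a∈R (proj₁ a⋱t)))
        where
        a∈R = ∈R (∈-++⁺ˡ a∈)
        a⋱t = All.head (All.lookup c₀⋱t a∈)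
      M′-fits : All (Southeast (lo t) (w t)) (reverse (map w c₀))
      M′-fits = All-reverse⁺ (All.map⁺ (All.tabulate fits))

    chain : ∃[ c ] c ⊆ reverse R × AllPairs _⋰_ c × length (reverse R) ≤ q * length c
    chain = increasing-subsequence q (reverse R)
      (AllPairs-reverse⁺ (AllPairs-map-under {S = λ a b → val (w b) < val (w a)} R-right
                            (λ {a} {b} → before⇒above {a} {b}) R-before))
      no-long-⋱

  hi-side-bound : ∀ {F} → AllPairs Before F →
                  length (filter isAboveHi? F) + length (filter isLeftOfHi? F) ≤ p * (r ∸ 2)
  hi-side-bound {F} F-before
    with cT , cT⊆ , cT⋰ , |T|≤ ← AboveFamily.chain (AllPairs.filter⁺ isAboveHi? F-before) (All.all-filter isAboveHi? F)
       | cL , cL⊆ , cL⋰ , |L|≤ ← LeftFamily.chain (AllPairs.filter⁺ isLeftOfHi? F-before) (All.all-filter isLeftOfHi? F)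
    = begin
      length T + length L           ≤⟨ +-mono-≤ |T|≤ (subst (_≤ p * length cL) (length-reverse L) |L|≤) ⟩
      p * length cT + p * length cL ≡⟨ *-distribˡ-+ p (length cT) (length cL) ⟨
      p * (length cT + length cL)   ≤⟨ *-monoʳ-≤-if-pos p chains-short ⟩
      p * (r ∸ 2)                   ∎
    where
    open ≤-Reasoning
    T = filter isAboveHi? F
    L = filter isLeftOfHi? F
    chains-short : 0 < p → length cT + length cL ≤ r ∸ 2
    chains-short 0<p with u , u∈Λ , Λ⪯u ← AllPairs-last (subst (0 <_) (sym |Λ|) 0<p) Λ↘ =
      subst (_≤ r ∸ 2) (+-comm (length cL) (length cT))
            (+-suc-<⇒≤∸2 (subst (_< r) |chain| (↗-chain-length avoids-α chain↗)))
      where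
      open HiPivot u∈Λ Λ⪯u
      chain : List Point
      chain = map w cL ++ u ∷ map w cT
      |chain| : length chain ≡ length cL + suc (length cT)
      |chain| = trans (length-++ (map w cL)) (cong₂ (λ a b → a + suc b) (length-map w cL) (length-map w cT))
      chain↗ : AllPairs _↗_ chain
      chain↗ = AllPairs-++-∷⁺ ↗-trans (AllPairs.map⁺ (AllPairs.map swap cL⋰))
        (All.map⁺ (All.tabulate λ {g} g∈ →
           left↗u g (All.lookup (All.all-filter isLeftOfHi? F) (Any.reverse⁻ (cL⊆ g∈)))))
        (All.map⁺ (All.tabulate λ {g} g∈ → u↗above g (All.lookup (All.all-filter isAboveHi? F) (cT⊆ g∈)))
         ∷ AllPairs.map⁺ cT⋰)

  lo-side-bound : ∀ {F} → AllPairs Before F →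
                  length (filter isBelowLo? F) + length (filter isRightOfLo? F) ≤ q * (r ∸ 2)
  lo-side-bound {F} F-before
    with cB , cB⊆ , cB⋰ , |B|≤ ← BelowFamily.chain (AllPairs.filter⁺ isBelowLo? F-before) (All.all-filter isBelowLo? F)
       | cR , cR⊆ , cR⋰ , |R|≤ ← RightFamily.chain (AllPairs.filter⁺ isRightOfLo? F-before) (All.all-filter isRightOfLo? F)
    = begin
      length B + length R           ≤⟨ +-mono-≤ |B|≤ (subst (_≤ q * length cR) (length-reverse R) |R|≤) ⟩
      q * length cB + q * length cR ≡⟨ *-distribˡ-+ q (length cB) (length cR) ⟨
      q * (length cB + length cR)   ≤⟨ *-monoʳ-≤-if-pos q chains-short ⟩
      q * (r ∸ 2)                   ∎
    where
    open ≤-Reasoning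
    B = filter isBelowLo? F
    R = filter isRightOfLo? F
    chains-short : 0 < q → length cB + length cR ≤ r ∸ 2
    chains-short 0<q with z , z∈M , z⪯M ← AllPairs-first (subst (0 <_) (sym |M|) 0<q) M↘ =
      +-suc-<⇒≤∸2 (subst (_< r) |chain| (↗-chain-length avoids-α chain↗))
      where
      open LoPivot z∈M z⪯M
      chain : List Point
      chain = map w cB ++ z ∷ map w cR
      |chain| : length chain ≡ length cB + suc (length cR)
      |chain| = trans (length-++ (map w cB)) (cong₂ (λ a b → a + suc b) (length-map w cB) (length-map w cR))
      chain↗ : AllPairs _↗_ chain
      chain↗ = AllPairs-++-∷⁺ ↗-trans (AllPairs.map⁺ cB⋰)
        (All.map⁺ (All.tabulate λ {g} g∈ → below↗z g (All.lookup (All.all-filter isBelowLo? F) (cB⊆ g∈))))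
        (All.map⁺ (All.tabulate λ {g} g∈ →
           z↗right g (All.lookup (All.all-filter isRightOfLo? F) (Any.reverse⁻ (cR⊆ g∈))))
         ∷ AllPairs.map⁺ (AllPairs.map swap cR⋰))

  gaps-bound : ∀ {gs} → AllPairs Before gs → length gs ≤ (p + q) * (r ∸ 2)
  gaps-bound {gs} gs-before = begin
    length gs                 ≤⟨ length-filter-cover hi-side? lo-side? {gs} (All.tabulate λ {g} _ → escapes g) ⟩
    length H + length L       ≤⟨ +-mono-≤
      (≤-trans (length-filter-cover isAboveHi? isLeftOfHi? (All.all-filter hi-side? gs))
               (hi-side-bound (AllPairs.filter⁺ hi-side? gs-before)))
      (≤-trans (length-filter-cover isBelowLo? isRightOfLo? (All.all-filter lo-side? gs))
               (lo-side-bound (AllPairs.filter⁺ lo-side? gs-before))) ⟩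
    p * (r ∸ 2) + q * (r ∸ 2) ≡⟨ *-distribʳ-+ (r ∸ 2) p q ⟨
    (p + q) * (r ∸ 2)         ∎
    where
    open ≤-Reasoning
    hi-side? : Decidable (λ g → IsAboveHi g ⊎ IsLeftOfHi g)
    hi-side? g = isAboveHi? g ⊎-dec isLeftOfHi? g
    lo-side? : Decidable (λ g → IsBelowLo g ⊎ IsRightOfLo g)
    lo-side? g = isBelowLo? g ⊎-dec isRightOfLo? g
    H = filter hi-side? gs
    L = filter lo-side? gs

  module _ (irreducible : Irreducible π) where

    gaps : ∀ {S} → Linked _⋖_ S → All (λ s → All (_⪯ s) Λ) S → All (λ s → All (s ⪯_) M) S →
           ∃[ gs ] AllPairs Before gs × All (λ g → hi g ∈ S) gs × length gs ≡ length S ∸ 1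
    gaps []          _ _ = [] , [] , [] , refl
    gaps [-]         _ _ = [] , [] , [] , refl
    gaps {x ∷ y ∷ S} (x⋖y ∷ linked) (Λ⪯x ∷ Λ⪯yS) (_ ∷ yS⪯M)
      with gs , before , his , |gs| ← gaps linked Λ⪯yS yS⪯M =
      g ∷ gs , All.map (ReflClosure-head (Linked⇒AllPairs ↘-trans (Linked.map proj₁ linked))) his ∷ before ,
      here refl ∷ All.map there his , cong suc |gs|
      where
      g : Gap
      g = record { hi = x ; lo = y ; w = proj₁ (escape irreducible x⋖y) ; hi↘lo = proj₁ x⋖y
                 ; Λ⪯hi = Λ⪯x ; lo⪯M = All.head yS⪯M ; escapes = proj₂ (escape irreducible x⋖y) }

    saturated-segment-bound : ∀ {S} → Linked _⋖_ S → All (λ s → All (_⪯ s) Λ) S → All (λ s → All (s ⪯_) M) S →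
                              length S ∸ 1 ≤ (p + q) * (r ∸ 2)
    saturated-segment-bound linked Λ⪯S S⪯M with gs , before , _ , |gs| ← gaps linked Λ⪯S S⪯M =
      subst (_≤ (p + q) * (r ∸ 2)) |gs| (gaps-bound before)

module Bounds {n} (π : Perm n) (irreducible : Irreducible π) {r p q : ℕ} (β : Perm (p + q + 2)) (isβ : IsBeta p q β)
              (avoids-α : Avoids π (α r)) (avoids-β : Avoids π β) where

  open Diagram π

  Bound : ℕ
  Bound = (p ∸ 1) + (q ∸ 1) + suc ((p + q) * (r ∸ 2))

  segment-bound : ∀ {S} → Linked _⋖_ S →
    (∃[ Λ ] length Λ ≡ p × AllPairs _↘_ Λ × All (λ s → All (_⪯ s) Λ) S) →
    (∃[ M ] length M ≡ q × AllPairs _↘_ M × All (λ s → All (s ⪯_) M) S) →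
    length S ∸ 1 ≤ (p + q) * (r ∸ 2)
  segment-bound S⋖ (Λ , |Λ| , Λ↘ , Λ⪯S) (M , |M| , M↘ , S⪯M) =
    Gaps.saturated-segment-bound π β isβ avoids-α avoids-β Λ M |Λ| |M| Λ↘ M↘ irreducible S⋖ Λ⪯S S⪯M

  -- Cutting D into A S B with |A| = p ∸ 1 and |B| = q ∸ 1 (rather than p and q) lets Λ and M share
  -- the first and last entry of S, so that the gaps of S include the two next to Λ and M.
  saturated-bound : ∀ {D} → Linked _⋖_ D → length D ≤ Bound
  saturated-bound {D} D⋖ with (p ∸ 1) + (q ∸ 1) <? length D
  ... | no  short = ≤-trans (≮⇒≥ short) (m≤m+n _ _)
  ... | yes long = begin
    length D                          ≡⟨ cong length D≡ASB ⟩
    length (A ++ S ++ B)              ≡⟨ trans (length-++ A) (cong₂ _+_ |A| (length-++ S)) ⟩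
    a + (length S + length B)         ≤⟨ +-monoʳ-≤ a (+-monoˡ-≤ (length B) |S|≤) ⟩
    a + (suc middle + length B)       ≡⟨ cong (λ l → a + (suc middle + l)) |B| ⟩
    a + (suc middle + b)              ≡⟨ a+[1+m+b]≡a+b+[1+m] a b middle ⟩
    Bound                             ∎
    where
    open ≤-Reasoning
    a = p ∸ 1
    b = q ∸ 1
    middle = (p + q) * (r ∸ 2)
    A = take a D
    T = drop a D
    S = take (length T ∸ b) T
    B = drop (length T ∸ b) T
    D≡ASB : D ≡ A ++ S ++ B
    D≡ASB = sym (trans (cong (A ++_) (take++drop≡id (length T ∸ b) T)) (take++drop≡id a D))
    a≤|D| : a ≤ length D
    a≤|D| = ≤-trans (m≤m+n a b) (<⇒≤ long)
    |A| : length A ≡ a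
    |A| = trans (length-take a D) (m≤n⇒m⊓n≡m a≤|D|)
    b<|T| : b < length T
    b<|T| = subst (b <_) (sym (length-drop a D))
                  (+-cancelˡ-< a b _ (subst (a + b <_) (sym (m+[n∸m]≡n a≤|D|)) long))
    |B| : length B ≡ b
    |B| = trans (length-drop (length T ∸ b) T) (m∸[m∸n]≡n (<⇒≤ b<|T|))
    0<|S| : 0 < length S
    0<|S| = subst (0 <_) (sym (trans (length-take (length T ∸ b) T) (m≤n⇒m⊓n≡m (m∸n≤m (length T) b))))
                  (m<n⇒0<n∸m b<|T|)
    ASB↘ : AllPairs _↘_ (A ++ S ++ B)
    ASB↘ = subst (AllPairs _↘_) D≡ASB (Linked⇒AllPairs ↘-trans (Linked.map proj₁ D⋖))
    AS↘ : AllPairs _↘_ (A ++ S)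
    AS↘ = proj₁ (AllPairs-++⁻ (A ++ S) (subst (AllPairs _↘_) (sym (++-assoc A S B)) ASB↘))
    SB↘ : AllPairs _↘_ (S ++ B)
    SB↘ = proj₁ (proj₂ (AllPairs-++⁻ A ASB↘))
    S⋖ : Linked _⋖_ S
    S⋖ = proj₁ (Linked-++⁻ S (proj₂ (Linked-++⁻ A (subst (Linked _⋖_) D≡ASB D⋖))))
    |S|≤ : length S ≤ suc middle
    |S|≤ = ≤-trans (m≤n+m∸n (length S) 1)
             (s≤s (segment-bound S⋖ (left-block p |A| 0<|S| AS↘) (right-block q |B| 0<|S| SB↘)))

  decreasing-bound : ∀ {D} → AllPairs _↘_ D → length D ≤ Bound
  decreasing-bound D↘ with D′ , D′⋖ , |D|≤|D′| ← saturate D↘ = ≤-trans |D|≤|D′| (saturated-bound D′⋖)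

  length-bound : n ≤ Bound * (r ∸ 1)
  length-bound = bound (increasing-subsequence Bound (allFin n) (AllPairs.tabulate⁺-< id) no-long-↘)
    where
    open ErdősSzekeres pos val (cong pos ∘ val-injective)
    bound : ∃[ c ] c ⊆ allFin n × AllPairs _↗_ c × length (allFin n) ≤ Bound * length c → n ≤ Bound * (r ∸ 1)
    bound (c , _ , c↗ , n≤) = ≤-trans (subst (_≤ Bound * length c) (length-tabulate id) n≤)
                                      (*-monoʳ-≤ Bound (<⇒≤∸1 (↗-chain-length avoids-α c↗)))
    no-long-↘ : ∀ c → c ⊆ allFin n → AllPairs _↘_ c → length c ≢ suc Bound
    no-long-↘ c _ c↘ |c| = <-irrefl refl (subst (_≤ Bound) |c| (decreasing-bound c↘))

private
  bound-when-both : ∀ r p q → 3 ≤ r → 1 ≤ p → 1 ≤ q →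
                    (p ∸ 1) + (q ∸ 1) + suc ((p + q) * (r ∸ 2)) ≡ (r ∸ 1) * (p + q) ∸ 1
  bound-when-both .(3 + r) (suc p) (suc q) (s≤s (s≤s (s≤s (z≤n {r})))) _ _ = identity p q r
    where
    identity : ∀ p q r → p + q + suc ((suc p + suc q) * suc r) ≡ p + suc q + suc r * (suc p + suc q)
    identity = solve-∀

  bound-when-p-zero : ∀ r p q → p ≡ 0 → 3 ≤ r → 1 ≤ p + q →
                      (p ∸ 1) + (q ∸ 1) + suc ((p + q) * (r ∸ 2)) ≤ (r ∸ 1) * (p + q)
  bound-when-p-zero .(3 + r) .0 (suc q) refl (s≤s (s≤s (s≤s (z≤n {r})))) _ = ≤-reflexive (identity q r)
    where
    identity : ∀ q r → q + suc (suc q * suc r) ≡ suc (suc r) * suc q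
    identity = solve-∀

  bound-when-q-zero : ∀ r p q → q ≡ 0 → 3 ≤ r → 1 ≤ p + q →
                      (p ∸ 1) + (q ∸ 1) + suc ((p + q) * (r ∸ 2)) ≤ (r ∸ 1) * (p + q)
  bound-when-q-zero .(3 + r) (suc p) .0 refl (s≤s (s≤s (s≤s (z≤n {r})))) _ = ≤-reflexive (identity p r)
    where
    identity : ∀ p r → p + 0 + suc ((suc p + 0) * suc r) ≡ suc (suc r) * (suc p + 0)
    identity = solve-∀

  x*a*x≡x*x*a : ∀ x a → x * a * x ≡ x * x * a
  x*a*x≡x*x*a = solve-∀

  [x*a∸1]*x≡x*x*a∸x : ∀ x a → (x * a ∸ 1) * x ≡ x * x * a ∸ x
  [x*a∸1]*x≡x*x*a∸x x a = trans (*-distribʳ-∸ x (x * a) 1) (cong₂ _∸_ (x*a*x≡x*x*a x a) (*-identityˡ x))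

lemma4p1 : ∀ (r p q : ℕ) → 3 ≤ r → 1 ≤ p + q →
    ∀ (β : Perm (p + q + 2)) → IsBeta p q β →
    ∀ (n : ℕ) (π : Perm n) → Irreducible π → Avoids π (α r) → Avoids π β →
    ((1 ≤ p → 1 ≤ q → ∀ m → HasDecreasing π m → m ≤ (r ∸ 1) * (p + q) ∸ 1)
     × ((p ≡ 0 → ∀ m → HasDecreasing π m → m ≤ (r ∸ 1) * (p + q))
     × (q ≡ 0 → ∀ m → HasDecreasing π m → m ≤ (r ∸ 1) * (p + q))))
    × ((1 ≤ p → 1 ≤ q → n ≤ (r ∸ 1) * (r ∸ 1) * (p + q) ∸ (r ∸ 1))
     × ((p ≡ 0 → n ≤ (r ∸ 1) * (r ∸ 1) * (p + q))
     × (q ≡ 0 → n ≤ (r ∸ 1) * (r ∸ 1) * (p + q))))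
lemma4p1 r p q 3≤r 1≤p+q β isβ n π irreducible avoids-α avoids-β =
  ( (λ 1≤p 1≤q m has → subst (m ≤_) (bound-when-both r p q 3≤r 1≤p 1≤q) (decreasing m has))
  , (λ p≡0 m has → ≤-trans (decreasing m has) (bound-when-p-zero r p q p≡0 3≤r 1≤p+q))
  , (λ q≡0 m has → ≤-trans (decreasing m has) (bound-when-q-zero r p q q≡0 3≤r 1≤p+q)) )
  , ( (λ 1≤p 1≤q → subst (n ≤_) (trans (cong (_* (r ∸ 1)) (bound-when-both r p q 3≤r 1≤p 1≤q))
                                       ([x*a∸1]*x≡x*x*a∸x (r ∸ 1) (p + q)))
                                length-bound)
    , (λ p≡0 → length-≤ (bound-when-p-zero r p q p≡0 3≤r 1≤p+q))
    , (λ q≡0 → length-≤ (bound-when-q-zero r p q q≡0 3≤r 1≤p+q)) )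
  where
  open Diagram π
  open Bounds π irreducible {r} {p} {q} β isβ avoids-α avoids-β

  decreasing : ∀ m → HasDecreasing π m → m ≤ Bound
  decreasing m has with c , c↘ , refl ← HasDecreasing⇒chain has = decreasing-bound c↘

  length-≤ : Bound ≤ (r ∸ 1) * (p + q) → n ≤ (r ∸ 1) * (r ∸ 1) * (p + q)
  length-≤ Bound≤ = ≤-trans length-bound
    (≤-trans (*-monoˡ-≤ (r ∸ 1) Bound≤) (≤-reflexive (x*a*x≡x*x*a (r ∸ 1) (p + q))))
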